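{- Let $n\ge 3$ be an integer such that $p=4n-1$ is prime. Let $m$ be an integer with $0\le m\le\lfloor (n^2-4n+5)/p\rfloor$, let $Q_m=\frac12+\frac12\sqrt{4mp+12n-7}$, and let $k_m=1+\lfloor Q_m\rfloor$. Then: (i) $3\le k_m\le n+2$; (ii) $1+\sqrt{4mp+12n-7}<2k_m<3+\sqrt{4mp+12n-7}$; (iii) $r_p((k_m-1)^2)+r_p(k_m+1-3n)\ge p$; (iv) $3n-k_m-1<r_p((k_m-1)^2)=(k_m-1)^2-mp\le 3n+k_m-4$.
   Context: For a positive integer $q$ and $x\in\mathbb{Z}$, $r_q(x)\in\{0,1,\dots,q-1\}$ denotes the remainder of $x$ upon division by $q$. Note $4mp+12n-7=4mp+3p-4$. -}

module Defs where

open import Data.Nat as ℕ using (ℕ; zero; suc)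
open import Data.Integer as ℤ using (ℤ; +_; _%ℕ_)
open import Data.Sum using (_⊎_)
open import Data.Product using (_×_)

-- r q x : remainder of x upon division by q, in {0,…,q-1} (for q > 0).
-- (Value at q = 0 is irrelevant; the statement only uses q = p prime.)
r : ℕ → ℤ → ℕ
r zero    x = 0
r (suc q) x = x %ℕ suc q

fdiv : ℕ → ℕ → ℕ
fdiv a zero    = 0
fdiv a (suc q) = a ℕ./ suc q

-- Exact comparisons between an integer a and the real number √D (D ≥ 0),
-- written without reals by squaring:
-- a ≤ √D
_≤√_ : ℤ → ℤ → Set
a ≤√ D = (a ℤ.≤ + 0) ⊎ (a ℤ.* a ℤ.≤ D)

_<√_ : ℤ → ℤ → Set
a <√ D = (a ℤ.< + 0) ⊎ (a ℤ.* a ℤ.< D)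

_√<_ : ℤ → ℤ → Set
D √< a = (+ 0 ℤ.< a) × (D ℤ.< a ℤ.* a)

-- t = ⌊ 1/2 + 1/2 √D ⌋, i.e.  t ≤ (1+√D)/2 < t+1,
-- i.e.  2t - 1 ≤ √D  and  √D < 2t + 1.
IsFloorQ : ℤ → ℤ → Set
IsFloorQ D t = ((+ 2 ℤ.* t ℤ.- + 1) ≤√ D) × (D √< (+ 2 ℤ.* t ℤ.+ + 1))

{-# OPTIONS --safe #-}
-- Write t = k − 1 and A = mp + 3n, so that 4mp + 12n − 7 = 4A − 7 and the floor condition reads
-- (2t − 1)² ≤ 4A − 7 < (2t + 1)², i.e. t² − t + 2 ≤ A ≤ t² + t + 1. The left inequality is strict:
-- equality would give (2t − 1)² + 4 = (4m + 3)p, whereas −4 is not a square modulo a prime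
-- p ≡ 3 (mod 4) by Fermat's little theorem, itself a consequence of the binomial theorem. Together with
-- mp + 4n ≤ n² + 5 these bounds force 2 ≤ t ≤ n + 1, so R = t² − mp satisfies
-- 3n − t − 1 ≤ R ≤ 3n + t − 3 < p. Hence R = r_p(t²), and t + 2 − 3n ∈ [−p, 0) has residue
-- n + t + 1; all four claims are then linear consequences.

module Submission where

open import Defs
open import Algebra.Bundles using (CommutativeSemiring)
import Algebra.Definitions.RawSemiring as RawSemiringDefinitions
import Algebra.Properties.CommutativeSemiring.Binomial as Binomial
import Algebra.Properties.Monoid.Sum as MonoidSum
open import Data.Fin as Fin using (Fin; toℕ; fromℕ; inject₁)
import Data.Fin.Properties as FinP
open import Data.Integer as ℤ using (ℤ; +_; -[1+_]; +≤+)
open import Data.Integer.Divisibility.Signed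
  using (_∣_; divides; ∣ᵤ⇒∣; ∣⇒∣ᵤ; ∣-refl; ∣m⇒∣-m; ∣m∣n⇒∣m+n; ∣m+n∣m⇒∣n; ∣m⇒∣m*n; ∣n⇒∣m*n)
import Data.Integer.Properties as ℤP
open import Data.List using (_∷_; [])
open import Data.Nat as ℕ using (ℕ; zero; suc; _!)
open import Data.Nat.Combinatorics using (_C_; nCk≡n!/k![n-k]!; k![n∸k]!∣n!; nCn≡1)
import Data.Nat.Divisibility as ℕ∣
open import Data.Nat.DivMod using (m/n*n≡m; m/n*n≤m; m<n⇒m%n≡m; [m+kn]%n≡m%n)
open import Data.Nat.Primality using (Prime; euclidsLemma; ¬prime[0]; ¬prime[1])
import Data.Nat.Properties as ℕP
open import Data.Product using (_×_; _,_; proj₁; proj₂)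
open import Data.Sum using (inj₁; inj₂)
open import Function using (_∘_; _⇔_; mk⇔; Equivalence)
open import Relation.Binary.Bundles using (Setoid)
open import Relation.Binary.PropositionalEquality
import Relation.Binary.Reasoning.Setoid as SetoidReasoning
open import Relation.Nullary using (contradiction)

module ModularArithmetic where

  open import Data.Integer using (_+_; _*_; _-_; -_; _^_)
  open import Data.Integer.Tactic.RingSolver using (solve; solve-∀)

  private
    module ℤBinomial = Binomial ℤP.+-*-commutativeSemiring
    module ℤSum = MonoidSum ℤP.+-0-monoid
    open RawSemiringDefinitions (CommutativeSemiring.rawSemiring ℤP.+-*-commutativeSemiring)
      using () renaming (_×_ to _×ᴿ_; _^_ to _^ᴿ_)

  infix 4 _≡_mod_
  record _≡_mod_ (a b m : ℤ) : Set where
    constructor mod-by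
    field divides-difference : m ∣ a - b

  module _ {m : ℤ} where

    ∣-respʳ : ∀ {x y} → m ∣ x → x ≡ y → m ∣ y
    ∣-respʳ m∣x refl = m∣x

    ≡+multiple⇒≡-mod : ∀ {a b} c → m ∣ c → a ≡ b + c → a ≡ b mod m
    ≡+multiple⇒≡-mod {b = b} c m∣c refl = mod-by (∣-respʳ m∣c (solve (b ∷ c ∷ [])))

    ≡⇒≡-mod : ∀ {a b} → a ≡ b → a ≡ b mod m
    ≡⇒≡-mod {a} refl = mod-by (divides (+ 0) (ℤP.+-inverseʳ a))

    ≡-mod-sym : ∀ {a b} → a ≡ b mod m → b ≡ a mod m
    ≡-mod-sym {a} {b} (mod-by m∣a-b) =
      mod-by (∣-respʳ (∣m⇒∣-m m∣a-b) (solve (a ∷ b ∷ [])))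

    ≡-mod-trans : ∀ {a b c} → a ≡ b mod m → b ≡ c mod m → a ≡ c mod m
    ≡-mod-trans {a} {b} {c} (mod-by m∣a-b) (mod-by m∣b-c) =
      mod-by (∣-respʳ (∣m∣n⇒∣m+n m∣a-b m∣b-c) (solve (a ∷ b ∷ c ∷ [])))

    ≡-mod-+ : ∀ {a b c d} → a ≡ b mod m → c ≡ d mod m → a + c ≡ b + d mod m
    ≡-mod-+ {a} {b} {c} {d} (mod-by m∣a-b) (mod-by m∣c-d) =
      mod-by (∣-respʳ (∣m∣n⇒∣m+n m∣a-b m∣c-d) (solve (a ∷ b ∷ c ∷ d ∷ [])))

    ≡-mod-* : ∀ {a b c d} → a ≡ b mod m → c ≡ d mod m → a * c ≡ b * d mod m
    ≡-mod-* {a} {b} {c} {d} (mod-by m∣a-b) (mod-by m∣c-d) =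
      mod-by (∣-respʳ (∣m∣n⇒∣m+n (∣m⇒∣m*n c m∣a-b) (∣n⇒∣m*n b m∣c-d)) (solve (a ∷ b ∷ c ∷ d ∷ [])))

    ≡-mod-*ˡ : ∀ c {a b} → a ≡ b mod m → c * a ≡ c * b mod m
    ≡-mod-*ˡ c = ≡-mod-* (≡⇒≡-mod {c} refl)

    ≡-mod-^ : ∀ {a b} k → a ≡ b mod m → a ^ k ≡ b ^ k mod m
    ≡-mod-^ zero    a≡b = ≡⇒≡-mod refl
    ≡-mod-^ (suc k) a≡b = ≡-mod-* a≡b (≡-mod-^ k a≡b)

  ≡-mod-setoid : ℤ → Setoid _ _
  ≡-mod-setoid m = record
    { Carrier       = ℤ
    ; _≈_           = _≡_mod m
    ; isEquivalence = record { refl = ≡⇒≡-mod refl ; sym = ≡-mod-sym ; trans = ≡-mod-trans } }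

  prime∣n!⇒p≤n : ∀ {p} n → Prime p → p ℕ∣.∣ n ! → p ℕ.≤ n
  prime∣n!⇒p≤n zero    pr p∣1 = contradiction (subst Prime (ℕ∣.∣1⇒≡1 p∣1) pr) ¬prime[1]
  prime∣n!⇒p≤n (suc n) pr p∣n! with euclidsLemma (suc n) (n !) pr p∣n!
  ... | inj₁ p∣1+n = ℕ∣.∣⇒≤ p∣1+n
  ... | inj₂ p∣n!  = ℕP.m≤n⇒m≤1+n (prime∣n!⇒p≤n n pr p∣n!)

  n!≡nCk*k!*[n∸k]! : ∀ {n k} → k ℕ.≤ n → n ! ≡ (n C k) ℕ.* (k ! ℕ.* (n ℕ.∸ k) !)
  n!≡nCk*k!*[n∸k]! {n} {k} k≤n = sym (begin
    (n C k) ℕ.* (k ! ℕ.* (n ℕ.∸ k) !)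
      ≡⟨ cong (ℕ._* (k ! ℕ.* (n ℕ.∸ k) !)) (nCk≡n!/k![n-k]! k≤n) ⟩
    (n ! ℕ./ (k ! ℕ.* (n ℕ.∸ k) !)) ℕ.* (k ! ℕ.* (n ℕ.∸ k) !)
      ≡⟨ m/n*n≡m (k![n∸k]!∣n! k≤n) ⟩
    n ! ∎)
    where open ≡-Reasoning
          instance _ = k ℕP.!* (n ℕ.∸ k) !≢0

  prime∣pCk : ∀ {p k} → Prime p → 0 ℕ.< k → k ℕ.< p → p ℕ∣.∣ p C k
  prime∣pCk {p@(suc q)} {k} pr 0<k k<p
    with euclidsLemma (p C k) _ pr (subst (p ℕ∣.∣_) (n!≡nCk*k!*[n∸k]! (ℕP.<⇒≤ k<p)) (ℕ∣.m∣m*n (q !)))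
  ... | inj₁ p∣pCk = p∣pCk
  ... | inj₂ p∣k![p∸k]! with euclidsLemma (k !) _ pr p∣k![p∸k]!
  ...   | inj₁ p∣k!     = contradiction (prime∣n!⇒p≤n k pr p∣k!) (ℕP.<⇒≱ k<p)
  ...   | inj₂ p∣[p∸k]! = contradiction (prime∣n!⇒p≤n (p ℕ.∸ k) pr p∣[p∸k]!) (ℕP.<⇒≱ (ℕP.∸-monoʳ-< 0<k (ℕP.<⇒≤ k<p)))

  -- The binomial theorem is stated with the semiring's own ℕ-action and power, which agree with
  -- + n * z and ℤ._^_ only propositionally.
  ×ᴿ≡* : ∀ n z → n ×ᴿ z ≡ + n * z
  ×ᴿ≡* zero    z = refl
  ×ᴿ≡* (suc n) z = trans (cong (_+_ z) (×ᴿ≡* n z)) (sym (ℤP.suc-* (+ n) z))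

  ^ᴿ≡^ : ∀ z n → z ^ᴿ n ≡ z ^ n
  ^ᴿ≡^ z zero    = refl
  ^ᴿ≡^ z (suc n) = cong (z *_) (^ᴿ≡^ z n)

  ∣-sum : ∀ {m n} (t : Fin n → ℤ) → (∀ i → m ∣ t i) → m ∣ ℤSum.sum t
  ∣-sum {n = zero}  t m∣t = divides (+ 0) refl
  ∣-sum {n = suc n} t m∣t = ∣m∣n⇒∣m+n (m∣t Fin.zero) (∣-sum (t ∘ Fin.suc) (m∣t ∘ Fin.suc))

  freshman's-dream : ∀ {p} → Prime p → ∀ x y → (x + y) ^ p ≡ x ^ p + y ^ p mod + p
  freshman's-dream {suc q} pr x y = ≡+multiple⇒≡-mod (ℤSum.sum middle) (∣-sum middle middle∣) (begin
    (x + y) ^ p                                   ≡⟨ ^ᴿ≡^ (x + y) p ⟨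
    (x + y) ^ᴿ p                                  ≡⟨ ℤBinomial.theorem p x y ⟩
    T Fin.zero + ℤSum.sum (T ∘ Fin.suc)           ≡⟨ cong (_+_ (T Fin.zero)) (ℤSum.sum-init-last (T ∘ Fin.suc)) ⟩
    T Fin.zero + (ℤSum.sum middle + T (fromℕ p))  ≡⟨ cong₂ (λ a b → a + (ℤSum.sum middle + b)) first last ⟩
    y ^ p + (ℤSum.sum middle + x ^ p)             ≡⟨ rearrange (x ^ p) (y ^ p) (ℤSum.sum middle) ⟩
    x ^ p + y ^ p + ℤSum.sum middle               ∎)
    where
    open ≡-Reasoning
    p : ℕ
    p = suc q
    T : Fin (suc p) → ℤ
    T = ℤBinomial.binomialTerm x y p
    middle : Fin q → ℤ
    middle i = T (Fin.suc (inject₁ i))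
    middle∣ : ∀ i → + p ∣ middle i
    middle∣ i = ∣-respʳ (∣m⇒∣m*n (ℤBinomial.binomial x y p k) (∣ᵤ⇒∣ {+ p} {+ (p C toℕ k)} p∣pCk))
                        (sym (×ᴿ≡* (p C toℕ k) (ℤBinomial.binomial x y p k)))
      where
      k : Fin (suc p)
      k = Fin.suc (inject₁ i)
      p∣pCk : p ℕ∣.∣ p C toℕ k
      p∣pCk = prime∣pCk pr (ℕ.s≤s ℕ.z≤n) (ℕ.s≤s (FinP.inject₁ℕ< i))
    -- p C 0 reduces to 1 by computation.
    first : T Fin.zero ≡ y ^ p
    first = trans (ℤP.+-identityʳ _) (trans (ℤP.*-identityˡ _) (^ᴿ≡^ y p))
    last : T (fromℕ p) ≡ x ^ p
    last = begin
      T (fromℕ p)                           ≡⟨ cong (λ j → (p C j) ×ᴿ (x ^ᴿ j * y ^ᴿ (p ℕ.∸ j))) (FinP.toℕ-fromℕ p) ⟩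
      (p C p) ×ᴿ (x ^ᴿ p * y ^ᴿ (p ℕ.∸ p))  ≡⟨ cong₂ (λ c e → c ×ᴿ (x ^ᴿ p * y ^ᴿ e)) (nCn≡1 p) (ℕP.n∸n≡0 p) ⟩
      x ^ᴿ p * + 1 + + 0                     ≡⟨ ℤP.+-identityʳ _ ⟩
      x ^ᴿ p * + 1                           ≡⟨ ℤP.*-identityʳ _ ⟩
      x ^ᴿ p                                 ≡⟨ ^ᴿ≡^ x p ⟩
      x ^ p                                  ∎
    rearrange : ∀ a b c → b + (c + a) ≡ a + b + c
    rearrange = solve-∀

  fermat : ∀ {p} → Prime p → ∀ a → (+ a) ^ p ≡ + a mod + p
  fermat {suc q} pr zero    = ≡⇒≡-mod refl
  fermat {p}     pr (suc a) = ≡-mod-trans (freshman's-dream pr (+ 1) (+ a))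
    (≡-mod-+ (≡⇒≡-mod (ℤP.^-zeroˡ p)) (fermat pr a))

  x^[2k]≡[x*x]^k : ∀ x k → x ^ (2 ℕ.* k) ≡ (x * x) ^ k
  x^[2k]≡[x*x]^k x k = begin
    x ^ (2 ℕ.* k)  ≡⟨ ℤP.^-*-assoc x 2 k ⟨
    (x ^ 2) ^ k    ≡⟨ cong (λ x² → (x * x²) ^ k) (ℤP.*-identityʳ x) ⟩
    (x * x) ^ k    ∎
    where open ≡-Reasoning

  prime+1≡4n⇒∤y*y+1 : ∀ {p n} y → Prime p → p ℕ.+ 1 ≡ 4 ℕ.* n → p ℕ∣.∤ y ℕ.* y ℕ.+ 1
  prime+1≡4n⇒∤y*y+1 {p} {n} y pr p+1≡4n p∣y*y+1 =
    ¬prime[1] (subst Prime (ℕ∣.∣1⇒≡1 (∣⇒∣ᵤ (∣m+n∣m⇒∣n {n = + 1} P∣P+1 ∣-refl))) pr)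
    where
    P Y : ℤ
    P = + p
    Y = + y
    P∣Y*Y+1 : P ∣ Y * Y + + 1
    P∣Y*Y+1 = ∣-respʳ (∣ᵤ⇒∣ {P} {+ (y ℕ.* y ℕ.+ 1)} p∣y*y+1) (cong (_+ + 1) (ℤP.pos-* y y))
    Y*Y≡-1 : Y * Y ≡ - + 1 mod P
    Y*Y≡-1 = ≡+multiple⇒≡-mod (Y * Y + + 1) P∣Y*Y+1 (shift (Y * Y))
      where shift : ∀ a → a ≡ - + 1 + (a + + 1)
            shift = solve-∀
    -1≡1 : - + 1 ≡ + 1 mod P
    -1≡1 = begin
      - + 1                  ≈⟨ ≡-mod-sym Y*Y≡-1 ⟩
      Y * Y                  ≈⟨ ≡-mod-*ˡ Y (≡-mod-sym (fermat pr y)) ⟩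
      Y ^ suc p              ≡⟨ cong (Y ^_) (trans (ℕP.+-comm 1 p) (trans p+1≡4n (ℕP.*-assoc 2 2 n))) ⟩
      Y ^ (2 ℕ.* (2 ℕ.* n))  ≡⟨ x^[2k]≡[x*x]^k Y (2 ℕ.* n) ⟩
      (Y * Y) ^ (2 ℕ.* n)    ≈⟨ ≡-mod-^ (2 ℕ.* n) Y*Y≡-1 ⟩
      (- + 1) ^ (2 ℕ.* n)    ≡⟨ x^[2k]≡[x*x]^k (- + 1) n ⟩
      (+ 1) ^ n              ≡⟨ ℤP.^-zeroˡ n ⟩
      + 1                    ∎
      where open SetoidReasoning (≡-mod-setoid P)
    P∣P+1 : P ∣ P + + 1
    P∣P+1 = ∣-respʳ (∣m⇒∣m*n (- (+ 2 * + n)) (_≡_mod_.divides-difference -1≡1)) (begin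
      (- + 1 - + 1) * (- (+ 2 * + n))  ≡⟨ double (+ n) ⟩
      + 4 * + n                        ≡⟨ ℤP.pos-* 4 n ⟨
      + (4 ℕ.* n)                      ≡⟨ cong +_ p+1≡4n ⟨
      P + + 1                          ∎)
      where open ≡-Reasoning
            double : ∀ ν → (- + 1 - + 1) * (- (+ 2 * ν)) ≡ + 4 * ν
            double = solve-∀

module NaturalBounds where

  open import Data.Nat
  open import Data.Nat.Properties
  open import Data.Nat.Tactic.RingSolver using (solve)
  open import Relation.Nullary.Decidable using (yes; no; from-no)
  open ModularArithmetic using (prime+1≡4n⇒∤y*y+1)

  -- The identity, checked by the ring solver, exhibits y ∸ x as d + (b ∸ a).
  ≤-by-certificate : ∀ {a b x y} d → a ≤ b → x + d + b ≡ y + a → x ≤ y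
  ≤-by-certificate {a} {b} {x} {y} d a≤b eq = ≤-trans (m≤m+n x d)
    (+-cancelʳ-≤ b (x + d) y (≤-trans (≤-reflexive eq) (+-monoʳ-≤ y a≤b)))

  infixl 6 _⊕_
  _⊕_ : ∀ {a b c d} → a ≤ b → c ≤ d → a + c ≤ b + d
  _⊕_ = +-mono-≤

  4n≤n*n+4 : ∀ n → 4 * n ≤ n * n + 4
  4n≤n*n+4 0             = z≤n
  4n≤n*n+4 1             = n≤1+n 4
  4n≤n*n+4 (suc (suc e)) = ≤-by-certificate (e * e) (z≤n {0}) (solve (e ∷ []))

  mp+4n≤n*n+5 : ∀ {n p m} .{{_ : NonZero p}} → m ≤ (n * n + 5 ∸ 4 * n) / p → m * p + 4 * n ≤ n * n + 5
  mp+4n≤n*n+5 {n} {p} {m} m≤[n*n+5∸4n]/p = begin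
    m * p + 4 * n              ≤⟨ +-monoˡ-≤ (4 * n) (≤-trans (*-monoˡ-≤ p m≤[n*n+5∸4n]/p) (m/n*n≤m _ p)) ⟩
    n * n + 5 ∸ 4 * n + 4 * n  ≡⟨ m∸n+n≡m (≤-trans (4n≤n*n+4 n) (+-monoʳ-≤ (n * n) (n≤1+n 4))) ⟩
    n * n + 5                  ∎
    where open ≤-Reasoning

  p≡4n∸1⇒p+1≡4n : ∀ {n p} → 1 ≤ n → p ≡ 4 * n ∸ 1 → p + 1 ≡ 4 * n
  p≡4n∸1⇒p+1≡4n 1≤n refl = m∸n+n≡m (≤-trans (s≤s z≤n) (*-monoʳ-≤ 4 1≤n))

  -- 2n inverts 2 modulo p, so y = 2nz satisfies y * y + 1 ≡ n (z * z + 4).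
  prime+1≡4n⇒∤z*z+4 : ∀ {p n} z → Prime p → p + 1 ≡ 4 * n → p ℕ∣.∤ z * z + 4
  prime+1≡4n⇒∤z*z+4 {p} {n} z pr p+1≡4n p∣z*z+4 =
    prime+1≡4n⇒∤y*y+1 {n = n} (2 * n * z) pr p+1≡4n (ℕ∣.∣m+n∣m⇒∣n p∣p+y*y+1 ℕ∣.∣-refl)
    where
    p∣p+y*y+1 : p ℕ∣.∣ p + ((2 * n * z) * (2 * n * z) + 1)
    p∣p+y*y+1 = subst (p ℕ∣.∣_) (begin
      n * (z * z + 4) + n * z * z * p         ≡⟨ solve (n ∷ z ∷ p ∷ []) ⟩
      (p + 1) * (n * z * z) + 4 * n           ≡⟨ cong₂ (λ a b → a * (n * z * z) + b) p+1≡4n (sym p+1≡4n) ⟩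
      4 * n * (n * z * z) + (p + 1)           ≡⟨ solve (n ∷ z ∷ p ∷ []) ⟩
      p + ((2 * n * z) * (2 * n * z) + 1)     ∎)
      (ℕ∣.∣m∣n⇒∣m+n (ℕ∣.∣n⇒∣m*n n p∣z*z+4) (ℕ∣.n∣m*n (n * z * z)))
      where open ≡-Reasoning

  module _ {n p m : ℕ} where

    t*t+2≢mp+3n+t : Prime p → p + 1 ≡ 4 * n → ∀ {t} → 1 ≤ t → t * t + 2 ≢ m * p + 3 * n + t
    t*t+2≢mp+3n+t pr p+1≡4n {suc s} _ eq = prime+1≡4n⇒∤z*z+4 {n = n} (2 * s + 1) pr p+1≡4n
      (ℕ∣.divides (4 * m + 3) (+-cancelʳ-≡ (4 * s + 7) _ _ (begin
        (2 * s + 1) * (2 * s + 1) + 4 + (4 * s + 7)  ≡⟨ solve (s ∷ []) ⟩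
        4 * (suc s * suc s + 2)                     ≡⟨ cong (4 *_) eq ⟩
        4 * (m * p + 3 * n + suc s)                 ≡⟨ solve (s ∷ n ∷ m ∷ p ∷ []) ⟩
        4 * (m * p) + 3 * (4 * n) + 4 * suc s       ≡⟨ cong (λ x → 4 * (m * p) + 3 * x + 4 * suc s) p+1≡4n ⟨
        4 * (m * p) + 3 * (p + 1) + 4 * suc s       ≡⟨ solve (s ∷ m ∷ p ∷ []) ⟩
        (4 * m + 3) * p + (4 * s + 7)               ∎)))
      where open ≡-Reasoning

  module _ {n p m : ℕ} (3≤n : 3 ≤ n) where

    private
      9≤mp+3n : 9 ≤ m * p + 3 * n
      9≤mp+3n = ≤-trans (*-monoʳ-≤ 3 3≤n) (m≤n+m (3 * n) (m * p))

    upper⇒2≤t : ∀ t → m * p + 3 * n ≤ t * t + t + 1 → 2 ≤ t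
    upper⇒2≤t 0             upper = contradiction (≤-trans 9≤mp+3n upper) (from-no (9 ≤? 1))
    upper⇒2≤t 1             upper = contradiction (≤-trans 9≤mp+3n upper) (from-no (9 ≤? 3))
    upper⇒2≤t (suc (suc _)) _     = s≤s (s≤s z≤n)

    module Bounds (p+1≡4n : p + 1 ≡ 4 * n) (hm : m * p + 4 * n ≤ n * n + 5) {t : ℕ}
                  (upper : m * p + 3 * n ≤ t * t + t + 1) (lower : t * t + 2 < m * p + 3 * n + t) where

      t<n+2 : t < n + 2
      t<n+2 with t <? n + 2
      ... | yes t<n+2 = t<n+2
      ... | no  t≮n+2 with e , n+2+e≡t ← m≤n⇒∃[o]m+o≡n (≮⇒≥ t≮n+2) =
        contradiction 4n≤0 (<⇒≱ (≤-trans (s≤s z≤n) (*-monoʳ-≤ 4 3≤n)))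
        where
        lower′ : (n + 2 + e) * (n + 2 + e) + 2 < m * p + 3 * n + (n + 2 + e)
        lower′ = subst (λ u → u * u + 2 < m * p + 3 * n + u) (sym n+2+e≡t) lower
        4n≤0 : 4 * n ≤ 0
        4n≤0 = ≤-by-certificate (e * (2 * n + 3) + e * e) (lower′ ⊕ hm) (solve (n ∷ m ∷ p ∷ e ∷ []))

      mp≤t*t : m * p ≤ t * t
      mp≤t*t = ≤-by-certificate (n + 1) (upper ⊕ t<n+2 ⊕ 3≤n) (solve (n ∷ m ∷ p ∷ t ∷ []))

      n+t+1<p : n + t + 1 < p
      n+t+1<p = ≤-by-certificate 2 (t<n+2 ⊕ 3≤n ⊕ 3≤n ⊕ ≤-reflexive (sym p+1≡4n)) (solve (n ∷ p ∷ t ∷ []))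

      module Remainder {R : ℕ} (t*t≡mp+R : t * t ≡ m * p + R) where

        3n<R+t+2 : 3 * n < R + (t + 2)
        3n<R+t+2 = ≤-by-certificate 0 (subst (λ s → m * p + 3 * n ≤ s + t + 1) t*t≡mp+R upper)
                                      (solve (n ∷ m ∷ p ∷ t ∷ R ∷ []))

        R+3≤3n+t : R + 3 ≤ 3 * n + t
        R+3≤3n+t = ≤-by-certificate 0 (subst (λ s → s + 2 < m * p + 3 * n + t) t*t≡mp+R lower)
                                      (solve (n ∷ m ∷ p ∷ t ∷ R ∷ []))

        R<p : R < p
        R<p = ≤-by-certificate 0 (R+3≤3n+t ⊕ t<n+2 ⊕ ≤-reflexive (sym p+1≡4n)) (solve (n ∷ p ∷ t ∷ R ∷ []))

        p≤R+[n+t+1] : p ≤ R + (n + t + 1)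
        p≤R+[n+t+1] = ≤-by-certificate 1 (3n<R+t+2 ⊕ ≤-reflexive p+1≡4n) (solve (n ∷ p ∷ t ∷ R ∷ []))

module IntegerBounds where

  open import Data.Integer using (_+_; _*_; _-_; -_; _≤_; _<_; +<+; _%ℕ_)
  open import Data.Integer.Tactic.RingSolver using (solve; solve-∀)
  open import Data.Nat using (_∸_)
  open NaturalBounds using (upper⇒2≤t; t*t+2≢mp+3n+t)

  module _ {x y c : ℤ} {a b : ℕ} (x+c≡a : x + c ≡ + a) (y+c≡b : y + c ≡ + b) where

    private
      unshift : ∀ z → z + c - c ≡ z
      unshift z = solve (z ∷ c ∷ [])

    shift-≤ : x ≤ y ⇔ a ℕ.≤ b
    shift-≤ = mk⇔
      (λ x≤y → ℤP.drop‿+≤+ (subst₂ _≤_ x+c≡a y+c≡b (ℤP.+-monoˡ-≤ c x≤y)))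
      (λ a≤b → subst₂ _≤_ (unshift x) (unshift y)
        (ℤP.+-monoˡ-≤ (- c) (subst₂ _≤_ (sym x+c≡a) (sym y+c≡b) (+≤+ a≤b))))

    shift-< : x < y ⇔ a ℕ.< b
    shift-< = mk⇔
      (λ x<y → ℤP.drop‿+<+ (subst₂ _<_ x+c≡a y+c≡b (ℤP.+-monoˡ-< c x<y)))
      (λ a<b → subst₂ _<_ (unshift x) (unshift y)
        (ℤP.+-monoˡ-< (- c) (subst₂ _<_ (sym x+c≡a) (sym y+c≡b) (+<+ a<b))))

  4mp+12n-7≡4[mp+3n]-7 : ∀ n m p → + 4 * + m * + p + + 12 * + n - + 7 ≡ + 4 * + (m ℕ.* p ℕ.+ 3 ℕ.* n) - + 7
  4mp+12n-7≡4[mp+3n]-7 n m p =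
    trans (regroup (+ m) (+ p) (+ n)) (cong (λ x → + 4 * x - + 7) (sym (cong₂ _+_ (ℤP.pos-* m p) (ℤP.pos-* 3 n))))
    where regroup : ∀ μ π ν → + 4 * μ * π + + 12 * ν - + 7 ≡ + 4 * (μ * π + + 3 * ν) - + 7
          regroup = solve-∀

  module Floor (A t : ℕ) where

    private
      T : ℤ
      T = + t

      D : ℤ
      D = + 4 * + A - + 7

      cast-4* : ∀ z → + 4 * + z ≡ + (4 ℕ.* z)
      cast-4* z = sym (ℤP.pos-* 4 z)

      T*T≡t*t : T * T ≡ + (t ℕ.* t)
      T*T≡t*t = sym (ℤP.pos-* t t)

      D+7 : D + + 7 ≡ + (4 ℕ.* A)
      D+7 = trans (cancel7 (+ A)) (cast-4* A)
        where cancel7 : ∀ a → + 4 * a - + 7 + + 7 ≡ + 4 * a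
              cancel7 = solve-∀

      [2T+1]²+7 : (+ 2 * T + + 1) * (+ 2 * T + + 1) + + 7 ≡ + (4 ℕ.* suc (t ℕ.* t ℕ.+ t ℕ.+ 1))
      [2T+1]²+7 = trans (expand T) (trans (cong (λ s → + 4 * (+ 1 + (s + T + + 1))) T*T≡t*t) (cast-4* (suc (t ℕ.* t ℕ.+ t ℕ.+ 1))))
        where expand : ∀ τ → (+ 2 * τ + + 1) * (+ 2 * τ + + 1) + + 7 ≡ + 4 * (+ 1 + (τ * τ + τ + + 1))
              expand = solve-∀

      D+4T+7 : D + (+ 4 * T + + 7) ≡ + (4 ℕ.* (A ℕ.+ t))
      D+4T+7 = trans (expand (+ A) T) (cast-4* (A ℕ.+ t))
        where expand : ∀ a τ → + 4 * a - + 7 + (+ 4 * τ + + 7) ≡ + 4 * (a + τ)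
              expand = solve-∀

      [2T-1]²+4T+7 : (+ 2 * T - + 1) * (+ 2 * T - + 1) + (+ 4 * T + + 7) ≡ + (4 ℕ.* (t ℕ.* t ℕ.+ 2))
      [2T-1]²+4T+7 = trans (expand T) (trans (cong (λ s → + 4 * (s + + 2)) T*T≡t*t) (cast-4* (t ℕ.* t ℕ.+ 2)))
        where expand : ∀ τ → (+ 2 * τ - + 1) * (+ 2 * τ - + 1) + (+ 4 * τ + + 7) ≡ + 4 * (τ * τ + + 2)
              expand = solve-∀

    upper-bound : D √< (+ 2 * T + + 1) → A ℕ.≤ t ℕ.* t ℕ.+ t ℕ.+ 1
    upper-bound (_ , D<[2T+1]²) =
      ℕ.s≤s⁻¹ (ℕP.*-cancelˡ-< 4 _ _ (Equivalence.to (shift-< D+7 [2T+1]²+7) D<[2T+1]²))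

    lower-bound : 1 ℕ.≤ t → (+ 2 * T - + 1) ≤√ D → t ℕ.* t ℕ.+ 2 ℕ.≤ A ℕ.+ t
    lower-bound 1≤t (inj₁ 2T-1≤0) =
      contradiction (Equivalence.to (shift-≤ 2T-1+1 refl) 2T-1≤0) (ℕP.<⇒≱ (ℕP.*-monoʳ-≤ 2 1≤t))
      where 2T-1+1 : + 2 * T - + 1 + + 1 ≡ + (2 ℕ.* t)
            2T-1+1 = trans (cancel1 T) (sym (ℤP.pos-* 2 t))
              where cancel1 : ∀ τ → + 2 * τ - + 1 + + 1 ≡ + 2 * τ
                    cancel1 = solve-∀
    lower-bound _ (inj₂ [2T-1]²≤D) =
      ℕP.*-cancelˡ-≤ 4 (Equivalence.to (shift-≤ [2T-1]²+4T+7 D+4T+7) [2T-1]²≤D)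

    <√-from-lower : t ℕ.* t ℕ.+ 2 ℕ.< A ℕ.+ t → (+ 2 * T - + 1) <√ D
    <√-from-lower lower = inj₂ (Equivalence.from (shift-< [2T-1]²+4T+7 D+4T+7) (ℕP.*-monoʳ-< 4 lower))

  module FloorBounds {n p m t : ℕ} (3≤n : 3 ℕ.≤ n) (pr : Prime p) (p+1≡4n : p ℕ.+ 1 ≡ 4 ℕ.* n)
                     (floor : IsFloorQ (+ 4 * + m * + p + + 12 * + n - + 7) (+ t)) where

    private
      A : ℕ
      A = m ℕ.* p ℕ.+ 3 ℕ.* n
      floor′ : IsFloorQ (+ 4 * + A - + 7) (+ t)
      floor′ = subst (λ D → IsFloorQ D (+ t)) (4mp+12n-7≡4[mp+3n]-7 n m p) floor

    upper : A ℕ.≤ t ℕ.* t ℕ.+ t ℕ.+ 1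
    upper = Floor.upper-bound A t (proj₂ floor′)

    2≤t : 2 ℕ.≤ t
    2≤t = upper⇒2≤t {p = p} {m} 3≤n t upper

    lower : t ℕ.* t ℕ.+ 2 ℕ.< A ℕ.+ t
    lower = ℕP.≤∧≢⇒< (Floor.lower-bound A t 1≤t (proj₁ floor′)) (t*t+2≢mp+3n+t {n} {p} {m} pr p+1≡4n 1≤t)
      where 1≤t : 1 ℕ.≤ t
            1≤t = ℕP.≤-trans (ℕ.s≤s ℕ.z≤n) 2≤t

    2t-1<√D : (+ 2 * + t - + 1) <√ (+ 4 * + m * + p + + 12 * + n - + 7)
    2t-1<√D = subst (_ <√_) (sym (4mp+12n-7≡4[mp+3n]-7 n m p)) (Floor.<√-from-lower A t lower)

  2[1+t]-3≡2t-1 : ∀ t → + 2 * + suc t - + 3 ≡ + 2 * + t - + 1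
  2[1+t]-3≡2t-1 t = shape (+ t)
    where shape : ∀ τ → + 2 * (+ 1 + τ) - + 3 ≡ + 2 * τ - + 1
          shape = solve-∀

  2[1+t]-1≡2t+1 : ∀ t → + 2 * + suc t - + 1 ≡ + 2 * + t + + 1
  2[1+t]-1≡2t+1 t = shape (+ t)
    where shape : ∀ τ → + 2 * (+ 1 + τ) - + 1 ≡ + 2 * τ + + 1
          shape = solve-∀

  -[1+j]%ℕd≡d∸[1+j] : ∀ {j d} .{{_ : ℕ.NonZero d}} → suc j ℕ.< d → -[1+ j ] %ℕ d ≡ d ∸ suc j
  -[1+j]%ℕd≡d∸[1+j] 1+j<d rewrite m<n⇒m%n≡m 1+j<d = refl

  [a-d]%ℕd≡a : ∀ {a d} .{{_ : ℕ.NonZero d}} → 0 ℕ.< a → a ℕ.< d → (+ a - + d) %ℕ d ≡ a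
  [a-d]%ℕd≡a {a} {d} 0<a a<d = begin
    (+ a - + d) %ℕ d        ≡⟨ cong (_%ℕ d) (trans (ℤP.[+m]-[+n]≡m⊖n a d) (ℤP.⊖-< a<d)) ⟩
    (- + (d ∸ a)) %ℕ d      ≡⟨ cong (λ k → (- + k) %ℕ d) d∸a≡1+j ⟩
    -[1+ d ∸ suc a ] %ℕ d   ≡⟨ -[1+j]%ℕd≡d∸[1+j] (subst (ℕ._< d) d∸a≡1+j (ℕP.∸-monoʳ-< 0<a (ℕP.<⇒≤ a<d))) ⟩
    d ∸ suc (d ∸ suc a)     ≡⟨ cong (d ∸_) d∸a≡1+j ⟨
    d ∸ (d ∸ a)             ≡⟨ ℕP.m∸[m∸n]≡n (ℕP.<⇒≤ a<d) ⟩
    a                       ∎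
    where
    open ≡-Reasoning
    d∸a≡1+j : d ∸ a ≡ suc (d ∸ suc a)
    d∸a≡1+j = ℕP.+-∸-assoc 1 a<d

  module _ (t m : ℕ) {p R : ℕ} (t*t≡mp+R : t ℕ.* t ≡ m ℕ.* p ℕ.+ R) where

    R≡t*t-mp : + R ≡ + t * + t - + m * + p
    R≡t*t-mp = begin
      + R                             ≡⟨ shape (+ m * + p) (+ R) ⟩
      + m * + p + + R - + m * + p     ≡⟨ cong (λ x → x + + R - + m * + p) (ℤP.pos-* m p) ⟨
      + (m ℕ.* p ℕ.+ R) - + m * + p   ≡⟨ cong (λ x → + x - + m * + p) t*t≡mp+R ⟨
      + (t ℕ.* t) - + m * + p         ≡⟨ cong (_- + m * + p) (ℤP.pos-* t t) ⟩
      + t * + t - + m * + p           ∎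
      where open ≡-Reasoning
            shape : ∀ x y → y ≡ x + y - x
            shape = solve-∀

    [t*t]%ℕp≡R : .{{_ : ℕ.NonZero p}} → R ℕ.< p → (+ t * + t) %ℕ p ≡ R
    [t*t]%ℕp≡R R<p = begin
      (+ t * + t) %ℕ p    ≡⟨ cong (_%ℕ p) (ℤP.pos-* t t) ⟨
      (t ℕ.* t) ℕ.% p     ≡⟨ cong (ℕ._% p) (trans t*t≡mp+R (ℕP.+-comm (m ℕ.* p) R)) ⟩
      (R ℕ.+ m ℕ.* p) ℕ.% p ≡⟨ [m+kn]%n≡m%n R m p ⟩
      R ℕ.% p             ≡⟨ m<n⇒m%n≡m R<p ⟩
      R                   ∎
      where open ≡-Reasoning

  module _ (n t : ℕ) {p : ℕ} (p+1≡4n : p ℕ.+ 1 ≡ 4 ℕ.* n) where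

    [t+2-3n]%ℕp≡n+t+1 : .{{_ : ℕ.NonZero p}} → n ℕ.+ t ℕ.+ 1 ℕ.< p → (+ suc t + + 1 - + 3 * + n) %ℕ p ≡ n ℕ.+ t ℕ.+ 1
    [t+2-3n]%ℕp≡n+t+1 n+t+1<p = trans (cong (_%ℕ p) t+2-3n≡[n+t+1]-p) ([a-d]%ℕd≡a (ℕP.m≤n+m 1 (n ℕ.+ t)) n+t+1<p)
      where
      4n-1≡p : + 4 * + n - + 1 ≡ + p
      4n-1≡p = begin
        + 4 * + n - + 1    ≡⟨ cong (_- + 1) (ℤP.pos-* 4 n) ⟨
        + (4 ℕ.* n) - + 1  ≡⟨ cong (λ x → + x - + 1) p+1≡4n ⟨
        + p + + 1 - + 1    ≡⟨ cancel (+ p) ⟩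
        + p                ∎
        where open ≡-Reasoning
              cancel : ∀ x → x + + 1 - + 1 ≡ x
              cancel = solve-∀
      t+2-3n≡[n+t+1]-p : + suc t + + 1 - + 3 * + n ≡ + (n ℕ.+ t ℕ.+ 1) - + p
      t+2-3n≡[n+t+1]-p = trans (shape (+ t) (+ n)) (cong (_-_ (+ (n ℕ.+ t ℕ.+ 1))) 4n-1≡p)
        where shape : ∀ τ ν → + 1 + τ + + 1 - + 3 * ν ≡ ν + τ + + 1 - (+ 4 * ν - + 1)
              shape = solve-∀

  3n-[1+t]-1<R : ∀ n t {R} → 3 ℕ.* n ℕ.< R ℕ.+ (t ℕ.+ 2) → + 3 * + n - + suc t - + 1 < + R
  3n-[1+t]-1<R n t = Equivalence.from (shift-< 3n-[1+t]-1+[t+2]≡3n refl)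
    where
    3n-[1+t]-1+[t+2]≡3n : + 3 * + n - + suc t - + 1 + + (t ℕ.+ 2) ≡ + (3 ℕ.* n)
    3n-[1+t]-1+[t+2]≡3n = trans (shape (+ n) (+ t)) (sym (ℤP.pos-* 3 n))
      where shape : ∀ ν τ → + 3 * ν - (+ 1 + τ) - + 1 + (τ + + 2) ≡ + 3 * ν
            shape = solve-∀

  R≤3n+[1+t]-4 : ∀ n t {R} → R ℕ.+ 3 ℕ.≤ 3 ℕ.* n ℕ.+ t → + R ≤ + 3 * + n + + suc t - + 4
  R≤3n+[1+t]-4 n t = Equivalence.from (shift-≤ refl 3n+[1+t]-4+3≡3n+t)
    where
    3n+[1+t]-4+3≡3n+t : + 3 * + n + + suc t - + 4 + + 3 ≡ + (3 ℕ.* n ℕ.+ t)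
    3n+[1+t]-4+3≡3n+t = trans (shape (+ n) (+ t)) (cong (_+ + t) (sym (ℤP.pos-* 3 n)))
      where shape : ∀ ν τ → + 3 * ν + (+ 1 + τ) - + 4 + + 3 ≡ + 3 * ν + τ
            shape = solve-∀

open NaturalBounds
open IntegerBounds

lemma2p7 : (n p m : ℕ) (k : ℤ) →
    3 ℕ.≤ n → p ≡ 4 ℕ.* n ℕ.∸ 1 → Prime p →
    m ℕ.≤ fdiv (n ℕ.* n ℕ.+ 5 ℕ.∸ 4 ℕ.* n) p →
    IsFloorQ (+ 4 ℤ.* + m ℤ.* + p ℤ.+ + 12 ℤ.* + n ℤ.- + 7) (k ℤ.- + 1) →
    ((+ 3 ℤ.≤ k) × (k ℤ.≤ + n ℤ.+ + 2))
    × ((+ 2 ℤ.* k ℤ.- + 3) <√ (+ 4 ℤ.* + m ℤ.* + p ℤ.+ + 12 ℤ.* + n ℤ.- + 7)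
       × ((+ 4 ℤ.* + m ℤ.* + p ℤ.+ + 12 ℤ.* + n ℤ.- + 7) √< (+ 2 ℤ.* k ℤ.- + 1)))
    × (p ℕ.≤ r p ((k ℤ.- + 1) ℤ.* (k ℤ.- + 1)) ℕ.+ r p (k ℤ.+ + 1 ℤ.- + 3 ℤ.* + n))
    × ((+ 3 ℤ.* + n ℤ.- k ℤ.- + 1 ℤ.< + r p ((k ℤ.- + 1) ℤ.* (k ℤ.- + 1)))
       × (+ r p ((k ℤ.- + 1) ℤ.* (k ℤ.- + 1)) ≡ (k ℤ.- + 1) ℤ.* (k ℤ.- + 1) ℤ.- + m ℤ.* + p)
       × ((k ℤ.- + 1) ℤ.* (k ℤ.- + 1) ℤ.- + m ℤ.* + p ℤ.≤ + 3 ℤ.* + n ℤ.+ k ℤ.- + 4))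
lemma2p7 n p m (+ 0)      _ _ _ _ (_ , () , _)
lemma2p7 n p m -[1+ _ ]   _ _ _ _ (_ , () , _)
lemma2p7 n 0 m (+ suc t)  _ _ pr _ _ = contradiction pr ¬prime[0]
lemma2p7 n p@(suc q) m (+ suc t) 3≤n p≡4n∸1 pr m≤⌊[n*n+5∸4n]/p⌋ floor =
  ( (+≤+ (ℕ.s≤s 2≤t) , +≤+ t<n+2)
  , ( subst (_<√ _) (sym (2[1+t]-3≡2t-1 t)) 2t-1<√D
    , subst (_ √<_) (sym (2[1+t]-1≡2t+1 t)) (proj₂ floor))
  , subst₂ (λ a b → p ℕ.≤ a ℕ.+ b) (sym r[t*t]≡R) (sym r[t+2-3n]≡n+t+1) p≤R+[n+t+1]
  , ( subst (ℤ._<_ _) (cong +_ (sym r[t*t]≡R)) (3n-[1+t]-1<R n t 3n<R+t+2)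
    , trans (cong +_ r[t*t]≡R) (R≡t*t-mp t m t*t≡mp+R)
    , subst (ℤ._≤ _) (R≡t*t-mp t m t*t≡mp+R) (R≤3n+[1+t]-4 n t R+3≤3n+t)))
  where
  p+1≡4n : p ℕ.+ 1 ≡ 4 ℕ.* n
  p+1≡4n = p≡4n∸1⇒p+1≡4n (ℕP.≤-trans (ℕ.s≤s ℕ.z≤n) 3≤n) p≡4n∸1
  open FloorBounds {n} {p} {m} {t} 3≤n pr p+1≡4n floor
  open Bounds {p = p} {m} 3≤n p+1≡4n (mp+4n≤n*n+5 {n} m≤⌊[n*n+5∸4n]/p⌋) upper lower
  R : ℕ
  R = t ℕ.* t ℕ.∸ m ℕ.* p
  t*t≡mp+R : t ℕ.* t ≡ m ℕ.* p ℕ.+ R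
  t*t≡mp+R = sym (ℕP.m+[n∸m]≡n mp≤t*t)
  open Remainder t*t≡mp+R
  r[t*t]≡R : r p (+ t ℤ.* + t) ≡ R
  r[t*t]≡R = [t*t]%ℕp≡R t m t*t≡mp+R R<p
  r[t+2-3n]≡n+t+1 : r p (+ suc t ℤ.+ + 1 ℤ.- + 3 ℤ.* + n) ≡ n ℕ.+ t ℕ.+ 1
  r[t+2-3n]≡n+t+1 = [t+2-3n]%ℕp≡n+t+1 n t p+1≡4n n+t+1<p
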